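{- Let $u$ and $v$ be $\mathbf c\mathbf d$-monomials of degree $m$ and $n$ respectively. Then \[ \beta(u \cdot v) = \binom {m+n+2}{m+1} \beta(u) \beta(v). \]
   Context: Let $\mathcal F = k\langle \mathbf c,\mathbf d\rangle$ ($k$ a field of characteristic 0, $\deg\mathbf c=1$, $\deg\mathbf d=2$) and $\hat{\mathcal F}=ke\oplus\mathcal F$ with $e$ a formal symbol of degree $-1$. Define $\Delta$ on $\mathcal F$ by $\Delta(1)=0$, $\Delta(\mathbf c)=2(1\otimes1)$, $\Delta(\mathbf d)=1\otimes\mathbf c+\mathbf c\otimes1$, $\Delta(uv)=\Delta(u)v+u\Delta(v)$, and $\hat\Delta(e)=e\otimes e$, $\hat\Delta(u)=\Delta(u)+e\otimes u+u\otimes e$. The product $\cdot$ on $\hat{\mathcal F}$ is the transpose of $\hat\Delta$ with respect to the basis of monomials (and $e$): the coefficient of $w$ in $u\cdot v$ equals the coefficient of $u\otimes v$ in $\hat\Delta(w)$; it has degree $+1$, so $u\cdot v$ has degree $m+n+1$. Explicitly, writing $\mathbf c^{m_1}\mathbf d\cdots\mathbf d\mathbf c^{m_k}$ as the list $(m_1,\dots,m_k)$, $(M',m)\cdot(n,N')=(M',m-1,n,N')+(M',m,n-1,N')+2(M',m+n+1,N')$ (lists with negative entries are zero), and $e$ is the unit. For a $\mathbf c\mathbf d$-monomial $v$ of degree $n$, $\beta(v)$ is the coefficient of $v$ in the $\mathbf c\mathbf d$-index $\Psi(B_{n+1})$ of the Boolean lattice of rank $n+1$; $\beta(e)=1$,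 and $\beta$ is extended linearly to $\hat{\mathcal F}$. -}

module Defs where

open import Data.Bool using (Bool; true; false; if_then_else_)
open import Data.Nat using (ℕ; zero; suc; _+_; _*_; _<ᵇ_)
open import Data.Integer using (ℤ; +_) renaming (_+_ to _+ℤ_; _*_ to _*ℤ_)
open import Data.List using (List; []; _∷_; map; concatMap; foldr; _++_; upTo)
open import Data.Nat.ListAction using (sum)
open import Data.List.NonEmpty using (List⁺; _∷_; _++⁺_; length)
import Data.List.NonEmpty as L⁺
open import Data.List.Properties using (≡-dec)
import Data.Bool.Properties as B
open import Data.Product using (_×_; _,_)
open import Relation.Nullary.Decidable using (does)
open import Relation.Binary.PropositionalEquality using (_≡_)

-- cd-monomials  c^{m₁} d c^{m₂} d ⋯ d c^{m_k}  as nonempty lists (m₁,…,m_k)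

CdMon : Set
CdMon = List⁺ ℕ

-- degree: deg c = 1, deg d = 2
deg : CdMon → ℕ
deg (x ∷ xs) = sum (x ∷ xs) + 2 * Data.List.length xs
  where import Data.List

_≟ᵐ_ : (u v : CdMon) → Bool
(x ∷ xs) ≟ᵐ (y ∷ ys) = does (≡-dec Data.Nat._≟_ (x ∷ xs) (y ∷ ys))
  where import Data.Nat

CdPoly : Set
CdPoly = List (ℤ × CdMon)

cdCoeff : CdPoly → CdMon → ℤ
cdCoeff [] v = + 0
cdCoeff ((k , u) ∷ p) v = (if u ≟ᵐ v then k else + 0) +ℤ cdCoeff p v

-- ab-words: a = false, b = true

_≟ʷ_ : List Bool → List Bool → Bool
w ≟ʷ w' = does (≡-dec B._≟_ w w')

-- all ab-words of length m (the expansion of c^m = (a+b)^m)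
allWords : ℕ → List (List Bool)
allWords zero = [] ∷ []
allWords (suc m) = map (false ∷_) (allWords m) ++ map (true ∷_) (allWords m)

_⊗_ : List (List Bool) → List (List Bool) → List (List Bool)
P ⊗ Q = concatMap (λ p → map (p ++_) Q) P

-- d = ab + ba
dWords : List (List Bool)
dWords = (false ∷ true ∷ []) ∷ (true ∷ false ∷ []) ∷ []

-- ab-expansion of a cd-monomial (c = a + b, d = ab + ba), as a multiset of words
expandL : ℕ → List ℕ → List (List Bool)
expandL x [] = allWords x
expandL x (y ∷ ys) = allWords x ⊗ (dWords ⊗ expandL y ys)

expand : CdMon → List (List Bool)
expand (x ∷ xs) = expandL x xs

countW : List Bool → List (List Bool) → ℕ
countW w ws = sum (map (λ w' → if w ≟ʷ w' then 1 else 0) ws)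

abCoeff : CdPoly → List Bool → ℤ
abCoeff [] w = + 0
abCoeff ((k , u) ∷ p) w = (k *ℤ + countW w (expand u)) +ℤ abCoeff p w

-- ab-index of the Boolean lattice B_{n+1}:
--   Ψ(B_{n+1}) = Σ_S β_{n+1}(S) u_S,  β_{n+1}(S) = #{ permutations of [n+1] with descent set S },
--   u_S = u₁⋯u_n with u_i = b if i ∈ S and a otherwise.

insertions : ℕ → List ℕ → List (List ℕ)
insertions x [] = (x ∷ []) ∷ []
insertions x (y ∷ ys) = (x ∷ y ∷ ys) ∷ map (y ∷_) (insertions x ys)

perms : List ℕ → List (List ℕ)
perms [] = [] ∷ []
perms (x ∷ xs) = concatMap (insertions x) (perms xs)

descWord : List ℕ → List Bool
descWord [] = []
descWord (x ∷ []) = []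
descWord (x ∷ y ∷ r) = (y <ᵇ x) ∷ descWord (y ∷ r)

-- coefficient of the ab-word w in Ψ(B_{n+1}) (zero if length w ≠ n)
abIndexB : ℕ → List Bool → ℤ
abIndexB n w = + countW w (map descWord (perms (upTo (suc n))))

-- ψ is the cd-index of B_{n+1}: its ab-expansion equals the ab-index of B_{n+1}
IsCdIndexB : ℕ → CdPoly → Set
IsCdIndexB n ψ = ∀ (w : List Bool) → abCoeff ψ w ≡ abIndexB n w

-- β, relative to a family ψ of cd-indices (ψ n = Ψ(B_{n+1})):
-- β(v) = coefficient of v in Ψ(B_{deg v + 1})

β : (ℕ → CdPoly) → CdMon → ℤ
β ψ v = cdCoeff (ψ (deg v)) v

βP : (ℕ → CdPoly) → CdPoly → ℤ
βP ψ [] = + 0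
βP ψ ((k , u) ∷ p) = (k *ℤ β ψ u) +ℤ βP ψ p

-- the product on monomials:
-- (M',m)·(n,N') = (M',m-1,n,N') + (M',m,n-1,N') + 2(M',m+n+1,N')

unsnoc : ℕ → List ℕ → List ℕ × ℕ
unsnoc x [] = [] , x
unsnoc x (y ∷ ys) with unsnoc y ys
... | I , l = (x ∷ I) , l

mkMon : List ℕ → ℕ → List ℕ → CdMon
mkMon M a N = M ++⁺ (a ∷ N)

_·_ : CdMon → CdMon → CdPoly
(x ∷ xs) · (n ∷ N') with unsnoc x xs
... | M' , m = t₁ m ++ t₂ n ++ ((+ 2 , mkMon M' (m + n + 1) N') ∷ [])
  where
    t₁ : ℕ → CdPoly
    t₁ zero = []
    t₁ (suc m') = (+ 1 , mkMon M' m' (n ∷ N')) ∷ []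
    t₂ : ℕ → CdPoly
    t₂ zero = []
    t₂ (suc n') = (+ 1 , mkMon (M' ++ m ∷ []) n' N') ∷ []

-- The ab-coefficients of Ψ(B_{n+1}) count the permutations of n + 1 values by descent word. For the
-- coproduct Δ w = Σ_{w = u x v} u ⊗ v on ab-words (x a letter), splitting a permutation of m + k + 2
-- values after position m + 1 amounts to choosing its first m + 1 values, so the component of
-- Δ Ψ(B_{m+k+2}) in bidegree (m, k) is C(m+k+2, m+1) Ψ(B_{m+1}) ⊗ Ψ(B_{k+1}); this is proved by
-- induction, inserting a new minimum into permutations. On cd-polynomials Δ restricts to the
-- cd-coproduct, whose transpose is ·, so for u, v of degrees m, n the coefficient of u · v in
-- Ψ(B_{m+n+2}) is the coefficient of u ⊗ v in Δ Ψ(B_{m+n+2}), that is C(m+n+2, m+1) β(u) β(v).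
module Submission where

open import Data.Bool using (Bool; true; false)
open import Data.List using (List; []; _∷_; _++_; length)
open import Relation.Binary.PropositionalEquality
open import Defs

Word : Set
Word = List Bool

pattern a = false
pattern b = true

module DescentCounts where
  open import Data.Nat
  open import Data.Nat.Properties
  open import Data.Nat.Combinatorics using (_C_; nCk+nC[k+1]≡[n+1]C[k+1]; nCn≡1)
  open import Data.Nat.Tactic.RingSolver using (solve-∀)
  open import Algebra.Properties.CommutativeSemigroup +-commutativeSemigroup using (interchange)
  open import Algebra.Properties.CommutativeSemigroup *-commutativeSemigroup using (xy∙z≈xz∙y)
  open ≡-Reasoning

  -- If f counts permutations by descent word, insertMin f counts by descent word the permutations
  -- obtained by inserting a new minimum: in front (prepending a), or after some entry, which turns that
  -- entry's letter into b a, or appends b after the last one. insertAfterHead f v accounts for the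
  -- word b ∷ v arising from an insertion after the first entry.
  insertFront : (Word → ℕ) → Word → ℕ
  insertFront f (a ∷ v) = f v
  insertFront f _ = 0

  insertAfterHead : (Word → ℕ) → Word → ℕ
  insertAfterHead f [] = f []
  insertAfterHead f (a ∷ v) = f (a ∷ v) + f (b ∷ v)
  insertAfterHead f (b ∷ v) = 0

  insertInner : (Word → ℕ) → Word → ℕ
  insertInner f [] = 0
  insertInner f (a ∷ v) = insertInner (λ u → f (a ∷ u)) v
  insertInner f (b ∷ v) = insertAfterHead f v + insertInner (λ u → f (b ∷ u)) v

  insertMin : (Word → ℕ) → Word → ℕ
  insertMin f w = insertFront f w + insertInner f w

  descentCount : ℕ → Word → ℕ
  descentCount zero [] = 1
  descentCount zero (_ ∷ _) = 0
  descentCount (suc n) = insertMin (descentCount n)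

  -- The coefficient of u ⊗ v in Δ f.
  cut : (Word → ℕ) → Word → Word → ℕ
  cut f u v = f (u ++ a ∷ v) + f (u ++ b ∷ v)

  whenEmpty : Word → ℕ → ℕ
  whenEmpty [] n = n
  whenEmpty (_ ∷ _) n = 0

  insertFront-scaleᴸ : ∀ k {f g} w → (∀ u → suc (length u) ≡ length w → f u ≡ k * g u) →
                       insertFront f w ≡ k * insertFront g w
  insertFront-scaleᴸ k [] h = sym (*-zeroʳ k)
  insertFront-scaleᴸ k (a ∷ v) h = h v refl
  insertFront-scaleᴸ k (b ∷ v) h = sym (*-zeroʳ k)

  insertAfterHead-scaleᴸ : ∀ k {f g} v → (∀ u → length u ≡ length v → f u ≡ k * g u) →
                           insertAfterHead f v ≡ k * insertAfterHead g v
  insertAfterHead-scaleᴸ k [] h = h [] refl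
  insertAfterHead-scaleᴸ k {g = g} (a ∷ v) h =
    trans (cong₂ _+_ (h (a ∷ v) refl) (h (b ∷ v) refl)) (sym (*-distribˡ-+ k (g (a ∷ v)) (g (b ∷ v))))
  insertAfterHead-scaleᴸ k (b ∷ v) h = sym (*-zeroʳ k)

  insertInner-scaleᴸ : ∀ k {f g} w → (∀ u → suc (length u) ≡ length w → f u ≡ k * g u) →
                       insertInner f w ≡ k * insertInner g w
  insertInner-scaleᴸ k [] h = sym (*-zeroʳ k)
  insertInner-scaleᴸ k (a ∷ v) h = insertInner-scaleᴸ k v (λ u e → h (a ∷ u) (cong suc e))
  insertInner-scaleᴸ k {g = g} (b ∷ v) h = begin
      insertAfterHead _ v + insertInner _ v
    ≡⟨ cong₂ _+_ (insertAfterHead-scaleᴸ k v (λ u e → h u (cong suc e)))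
                 (insertInner-scaleᴸ k v (λ u e → h (b ∷ u) (cong suc e))) ⟩
      k * insertAfterHead g v + k * insertInner (λ u → g (b ∷ u)) v
    ≡⟨ *-distribˡ-+ k _ _ ⟨
      k * insertInner g (b ∷ v)
    ∎

  insertMin-scaleᴸ : ∀ k {f g} w → (∀ u → suc (length u) ≡ length w → f u ≡ k * g u) →
                     insertMin f w ≡ k * insertMin g w
  insertMin-scaleᴸ k w h =
    trans (cong₂ _+_ (insertFront-scaleᴸ k w h) (insertInner-scaleᴸ k w h)) (sym (*-distribˡ-+ k _ _))

  insertMin-cong : ∀ {f g} → (∀ u → f u ≡ g u) → ∀ w → insertMin f w ≡ insertMin g w
  insertMin-cong {f} {g} h w =
    trans (insertMin-scaleᴸ 1 w (λ u _ → trans (h u) (sym (*-identityˡ (g u))))) (*-identityˡ _)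

  insertFront-+ : ∀ f g w → insertFront (λ u → f u + g u) w ≡ insertFront f w + insertFront g w
  insertFront-+ f g [] = refl
  insertFront-+ f g (a ∷ v) = refl
  insertFront-+ f g (b ∷ v) = refl

  insertAfterHead-+ : ∀ f g v → insertAfterHead (λ u → f u + g u) v ≡ insertAfterHead f v + insertAfterHead g v
  insertAfterHead-+ f g [] = refl
  insertAfterHead-+ f g (a ∷ v) = interchange (f (a ∷ v)) (g (a ∷ v)) (f (b ∷ v)) (g (b ∷ v))
  insertAfterHead-+ f g (b ∷ v) = refl

  insertInner-+ : ∀ f g w → insertInner (λ u → f u + g u) w ≡ insertInner f w + insertInner g w
  insertInner-+ f g [] = refl
  insertInner-+ f g (a ∷ v) = insertInner-+ (λ u → f (a ∷ u)) (λ u → g (a ∷ u)) v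
  insertInner-+ f g (b ∷ v) =
    trans (cong₂ _+_ (insertAfterHead-+ f g v) (insertInner-+ fb gb v))
          (interchange (insertAfterHead f v) (insertAfterHead g v) (insertInner fb v) (insertInner gb v))
    where
      fb gb : Word → ℕ
      fb u = f (b ∷ u)
      gb u = g (b ∷ u)

  insertMin-+ : ∀ f g w → insertMin (λ u → f u + g u) w ≡ insertMin f w + insertMin g w
  insertMin-+ f g w =
    trans (cong₂ _+_ (insertFront-+ f g w) (insertInner-+ f g w))
          (interchange (insertFront f w) (insertFront g w) (insertInner f w) (insertInner g w))

  cut-insertFront : ∀ f u v → cut (insertFront f) u v ≡ whenEmpty u (f v) + insertFront (λ u′ → cut f u′ v) u
  cut-insertFront f [] v = refl
  cut-insertFront f (a ∷ r) v = refl
  cut-insertFront f (b ∷ r) v = refl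

  cut-insertAfterHead : ∀ f u v → cut (insertAfterHead f) u v ≡ insertAfterHead (λ u′ → cut f u′ v) u
  cut-insertAfterHead f [] v = +-identityʳ _
  cut-insertAfterHead f (a ∷ r) v =
    interchange (f (a ∷ r ++ a ∷ v)) (f (b ∷ r ++ a ∷ v)) (f (a ∷ r ++ b ∷ v)) (f (b ∷ r ++ b ∷ v))
  cut-insertAfterHead f (b ∷ r) v = refl

  insertAfterHead-split : ∀ f v → insertAfterHead f v ≡ whenEmpty v (f []) + insertFront (cut f []) v
  insertAfterHead-split f [] = sym (+-identityʳ _)
  insertAfterHead-split f (a ∷ v) = refl
  insertAfterHead-split f (b ∷ v) = refl

  cut-insertInner : ∀ f u v → cut (insertInner f) u v ≡
                    whenEmpty v (f u) + insertInner (λ u′ → cut f u′ v) u + insertMin (cut f u) v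
  cut-insertInner f [] v = begin
      insertInner fa v + (insertAfterHead f v + insertInner fb v)
    ≡⟨ cong (λ x → insertInner fa v + (x + insertInner fb v)) (insertAfterHead-split f v) ⟩
      insertInner fa v + (whenEmpty v (f []) + insertFront (cut f []) v + insertInner fb v)
    ≡⟨ rearrange (insertInner fa v) (whenEmpty v (f [])) (insertFront (cut f []) v) (insertInner fb v) ⟩
      whenEmpty v (f []) + 0 + (insertFront (cut f []) v + (insertInner fa v + insertInner fb v))
    ≡⟨ cong (λ x → whenEmpty v (f []) + 0 + (insertFront (cut f []) v + x)) (insertInner-+ fa fb v) ⟨
      whenEmpty v (f []) + 0 + insertMin (cut f []) v
    ∎
    where
      fa fb : Word → ℕ
      fa u = f (a ∷ u)
      fb u = f (b ∷ u)
      rearrange : ∀ p q r s → p + (q + r + s) ≡ q + 0 + (r + (p + s))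
      rearrange = solve-∀
  cut-insertInner f (a ∷ r) v = cut-insertInner (λ u → f (a ∷ u)) r v
  cut-insertInner f (b ∷ r) v = begin
      insertAfterHead f X + insertInner fb X + (insertAfterHead f Y + insertInner fb Y)
    ≡⟨ interchange (insertAfterHead f X) (insertInner fb X) (insertAfterHead f Y) (insertInner fb Y) ⟩
      cut (insertAfterHead f) r v + cut (insertInner fb) r v
    ≡⟨ cong₂ _+_ (cut-insertAfterHead f r v) (cut-insertInner fb r v) ⟩
      insertAfterHead g r + (whenEmpty v (fb r) + insertInner (λ u′ → cut fb u′ v) r + insertMin (cut fb r) v)
    ≡⟨ rearrange (insertAfterHead g r) (whenEmpty v (fb r)) (insertInner (λ u′ → cut fb u′ v) r) _ ⟩
      whenEmpty v (f (b ∷ r)) + insertInner g (b ∷ r) + insertMin (cut f (b ∷ r)) v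
    ∎
    where
      fb g : Word → ℕ
      fb u = f (b ∷ u)
      g u = cut f u v
      X Y : Word
      X = r ++ a ∷ v
      Y = r ++ b ∷ v
      rearrange : ∀ p q r s → p + (q + r + s) ≡ q + (p + r) + s
      rearrange = solve-∀

  cut-insertMin : ∀ f u v → cut (insertMin f) u v ≡
                  (insertMin (λ u′ → cut f u′ v) u + whenEmpty u (f v)) + (insertMin (cut f u) v + whenEmpty v (f u))
  cut-insertMin f u v = begin
      insertFront f X + insertInner f X + (insertFront f Y + insertInner f Y)
    ≡⟨ interchange (insertFront f X) (insertInner f X) (insertFront f Y) (insertInner f Y) ⟩
      cut (insertFront f) u v + cut (insertInner f) u v
    ≡⟨ cong₂ _+_ (cut-insertFront f u v) (cut-insertInner f u v) ⟩
      whenEmpty u (f v) + insertFront g u + (whenEmpty v (f u) + insertInner g u + insertMin (cut f u) v)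
    ≡⟨ rearrange (whenEmpty u (f v)) (insertFront g u) (whenEmpty v (f u)) (insertInner g u) (insertMin (cut f u) v) ⟩
      (insertMin g u + whenEmpty u (f v)) + (insertMin (cut f u) v + whenEmpty v (f u))
    ∎
    where
      g : Word → ℕ
      g u′ = cut f u′ v
      X Y : Word
      X = u ++ a ∷ v
      Y = u ++ b ∷ v
      rearrange : ∀ p q r s t → p + q + (r + s + t) ≡ q + s + p + (t + r)
      rearrange = solve-∀

  CutDescentCount : ℕ → Set
  CutDescentCount n = ∀ {m k} u v → length u ≡ m → length v ≡ k → m + k ≡ n →
                      cut (descentCount (suc n)) u v ≡ (suc (suc n) C suc m) * descentCount m u * descentCount k v

  insertMin-cut-left : ∀ {n} → CutDescentCount n →
                       ∀ {m k} u v → length u ≡ m → length v ≡ k → m + k ≡ suc n →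
                       insertMin (λ u′ → cut (descentCount (suc n)) u′ v) u + whenEmpty u (descentCount (suc n) v) ≡
                       (suc (suc n) C m) * descentCount m u * descentCount k v
  insertMin-cut-left ih [] v refl ev refl = sym (*-identityˡ _)
  insertMin-cut-left {n} ih {k = k} (x ∷ r) v refl ev e = begin
      insertMin (λ u′ → cut (descentCount (suc n)) u′ v) (x ∷ r) + 0
    ≡⟨ +-identityʳ _ ⟩
      insertMin (λ u′ → cut (descentCount (suc n)) u′ v) (x ∷ r)
    ≡⟨ insertMin-scaleᴸ (binomial * B) (x ∷ r) (λ u′ e′ →
         trans (ih u′ v (suc-injective e′) ev (suc-injective e)) (xy∙z≈xz∙y binomial _ B)) ⟩
      binomial * B * descentCount (suc (length r)) (x ∷ r)
    ≡⟨ xy∙z≈xz∙y binomial B _ ⟩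
      binomial * descentCount (suc (length r)) (x ∷ r) * B
    ∎
    where
      binomial B : ℕ
      binomial = suc (suc n) C suc (length r)
      B = descentCount k v

  insertMin-cut-right : ∀ {n} → CutDescentCount n →
                        ∀ {m k} u v → length u ≡ m → length v ≡ k → m + k ≡ suc n →
                        insertMin (cut (descentCount (suc n)) u) v + whenEmpty v (descentCount (suc n) u) ≡
                        (suc (suc n) C suc m) * descentCount m u * descentCount k v
  insertMin-cut-right {n} ih {m} u [] eu refl e = begin
      descentCount (suc n) u
    ≡⟨ cong (λ j → descentCount j u) m≡1+n ⟨
      descentCount m u
    ≡⟨ *-identityˡ _ ⟨
      1 * descentCount m u
    ≡⟨ cong (_* descentCount m u) (trans (cong (λ j → suc j C suc m) (sym m≡1+n)) (nCn≡1 (suc m))) ⟨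
      (suc (suc n) C suc m) * descentCount m u
    ≡⟨ *-identityʳ _ ⟨
      (suc (suc n) C suc m) * descentCount m u * 1
    ∎
    where
      m≡1+n : m ≡ suc n
      m≡1+n = trans (sym (+-identityʳ m)) e
  insertMin-cut-right {n} ih {m} u (y ∷ s) eu refl e = trans (+-identityʳ _)
    (insertMin-scaleᴸ ((suc (suc n) C suc m) * descentCount m u) (y ∷ s) (λ v′ e′ →
       ih u v′ eu (suc-injective e′) (suc-injective (trans (sym (+-suc m (length s))) e))))

  cut-descentCount : ∀ n → CutDescentCount n
  cut-descentCount zero [] [] refl refl refl = refl
  cut-descentCount zero [] (_ ∷ _) refl refl ()
  cut-descentCount zero (_ ∷ _) _ refl _ ()
  cut-descentCount (suc n) {m} {k} u v eu ev e = begin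
      cut (insertMin α) u v
    ≡⟨ cut-insertMin α u v ⟩
      (insertMin (λ u′ → cut α u′ v) u + whenEmpty u (α v)) + (insertMin (cut α u) v + whenEmpty v (α u))
    ≡⟨ cong₂ _+_ (insertMin-cut-left (cut-descentCount n) u v eu ev e)
                 (insertMin-cut-right (cut-descentCount n) u v eu ev e) ⟩
      (suc (suc n) C m) * A * B + (suc (suc n) C suc m) * A * B
    ≡⟨ trans (cong (_* B) (*-distribʳ-+ A (suc (suc n) C m) (suc (suc n) C suc m)))
             (*-distribʳ-+ B ((suc (suc n) C m) * A) ((suc (suc n) C suc m) * A)) ⟨
      (suc (suc n) C m + suc (suc n) C suc m) * A * B
    ≡⟨ cong (λ x → x * A * B) (nCk+nC[k+1]≡[n+1]C[k+1] (suc (suc n)) m) ⟩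
      (suc (suc (suc n)) C suc m) * A * B
    ∎
    where
      α : Word → ℕ
      α = descentCount (suc n)
      A B : ℕ
      A = descentCount m u
      B = descentCount k v

module DescentWords where
  open import Data.Bool using (if_then_else_; not)
  open import Data.Nat using (ℕ; zero; suc; _+_; _<ᵇ_)
  open import Data.Nat.Properties using (+-identityʳ)
  open import Data.Nat.ListAction using (sum)
  open import Data.Nat.ListAction.Properties using (sum-++)
  open import Data.List using (map; concatMap; upTo; applyUpTo)
  open import Data.List.Properties
    using (map-++; map-∘; concatMap-++; concatMap-map; map-concatMap; concatMap-cong; map-applyUpTo)
  open import Function using (_∘_)
  open DescentCounts
  open ≡-Reasoning

  δʷ : Word → Word → ℕ
  δʷ u w = if w ≟ʷ u then 1 else 0

  countW-++ : ∀ w us vs → countW w (us ++ vs) ≡ countW w us + countW w vs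
  countW-++ w us vs =
    trans (cong sum (map-++ (λ u → δʷ u w) us vs)) (sum-++ (map (λ u → δʷ u w) us) (map (λ u → δʷ u w) vs))

  countW-[]-map : ∀ x us → countW [] (map (x ∷_) us) ≡ 0
  countW-[]-map x [] = refl
  countW-[]-map x (u ∷ us) = countW-[]-map x us

  countW-map-∷ : ∀ x w us → countW (x ∷ w) (map (x ∷_) us) ≡ countW w us
  countW-map-∷ x w [] = refl
  countW-map-∷ a w (u ∷ us) = cong (δʷ u w +_) (countW-map-∷ a w us)
  countW-map-∷ b w (u ∷ us) = cong (δʷ u w +_) (countW-map-∷ b w us)

  countW-map-∷-≢ : ∀ x w us → countW (not x ∷ w) (map (x ∷_) us) ≡ 0
  countW-map-∷-≢ x w [] = refl
  countW-map-∷-≢ a w (u ∷ us) = countW-map-∷-≢ a w us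
  countW-map-∷-≢ b w (u ∷ us) = countW-map-∷-≢ b w us

  -- insertMinWords u lists the descent words of the permutations obtained by inserting a new minimum
  -- into one with descent word u.
  insertInnerWords : Word → List Word
  insertInnerWords [] = (b ∷ []) ∷ []
  insertInnerWords (x ∷ u) = (b ∷ a ∷ u) ∷ map (x ∷_) (insertInnerWords u)

  insertMinWords : Word → List Word
  insertMinWords u = (a ∷ u) ∷ insertInnerWords u

  insertInner-zero : ∀ w → insertInner (λ _ → 0) w ≡ 0
  insertInner-zero w = insertInner-scaleᴸ 0 {g = λ _ → 0} w (λ _ _ → refl)

  insertAfterHead-δʷ : ∀ x u w → insertAfterHead (δʷ (x ∷ u)) w ≡ δʷ (a ∷ u) w
  insertAfterHead-δʷ x u [] = refl
  insertAfterHead-δʷ a u (a ∷ w) = +-identityʳ _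
  insertAfterHead-δʷ b u (a ∷ w) = refl
  insertAfterHead-δʷ x u (b ∷ w) = refl

  countW-insertInnerWords : ∀ u w → countW w (insertInnerWords u) ≡ insertInner (δʷ u) w
  countW-insertInnerWords [] [] = refl
  countW-insertInnerWords [] (a ∷ w) = sym (insertInner-zero w)
  countW-insertInnerWords [] (b ∷ []) = refl
  countW-insertInnerWords [] (b ∷ a ∷ w) = sym (insertInner-zero w)
  countW-insertInnerWords [] (b ∷ b ∷ w) = sym (insertInner-zero (b ∷ w))
  countW-insertInnerWords (x ∷ u) [] = countW-[]-map x (insertInnerWords u)
  countW-insertInnerWords (a ∷ u) (a ∷ w) =
    trans (countW-map-∷ a w (insertInnerWords u)) (countW-insertInnerWords u w)
  countW-insertInnerWords (b ∷ u) (a ∷ w) =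
    trans (countW-map-∷-≢ b w (insertInnerWords u)) (sym (insertInner-zero w))
  countW-insertInnerWords (x ∷ u) (b ∷ w) = cong₂ _+_ (sym (insertAfterHead-δʷ x u w)) (rest x)
    where
      rest : ∀ x → countW (b ∷ w) (map (x ∷_) (insertInnerWords u)) ≡
                   insertInner (λ v → δʷ (x ∷ u) (b ∷ v)) w
      rest a = trans (countW-map-∷-≢ a w (insertInnerWords u)) (sym (insertInner-zero w))
      rest b = trans (countW-map-∷ b w (insertInnerWords u)) (countW-insertInnerWords u w)

  countW-insertMinWords : ∀ u w → countW w (insertMinWords u) ≡ insertMin (δʷ u) w
  countW-insertMinWords u w = cong₂ _+_ (insertFront-δʷ w) (countW-insertInnerWords u w)
    where
      insertFront-δʷ : ∀ w → δʷ (a ∷ u) w ≡ insertFront (δʷ u) w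
      insertFront-δʷ [] = refl
      insertFront-δʷ (a ∷ w) = refl
      insertFront-δʷ (b ∷ w) = refl

  countW-concatMap-insertMinWords : ∀ us w →
                                    countW w (concatMap insertMinWords us) ≡ insertMin (λ u → countW u us) w
  countW-concatMap-insertMinWords [] w = sym (insertMin-scaleᴸ 0 {g = λ _ → 0} w (λ _ _ → refl))
  countW-concatMap-insertMinWords (u ∷ us) w = begin
      countW w (insertMinWords u ++ concatMap insertMinWords us)
    ≡⟨ countW-++ w (insertMinWords u) (concatMap insertMinWords us) ⟩
      countW w (insertMinWords u) + countW w (concatMap insertMinWords us)
    ≡⟨ cong₂ _+_ (countW-insertMinWords u w) (countW-concatMap-insertMinWords us w) ⟩
      insertMin (δʷ u) w + insertMin (λ v → countW v us) w
    ≡⟨ insertMin-+ (δʷ u) (λ v → countW v us) w ⟨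
      insertMin (λ v → countW v (u ∷ us)) w
    ∎

  insertions-map : ∀ (f : ℕ → ℕ) x ys → insertions (f x) (map f ys) ≡ map (map f) (insertions x ys)
  insertions-map f x [] = refl
  insertions-map f x (y ∷ ys) = cong ((f x ∷ f y ∷ map f ys) ∷_) (begin
      map (f y ∷_) (insertions (f x) (map f ys))
    ≡⟨ cong (map (f y ∷_)) (insertions-map f x ys) ⟩
      map (f y ∷_) (map (map f) (insertions x ys))
    ≡⟨ map-∘ (insertions x ys) ⟨
      map (λ zs → f y ∷ map f zs) (insertions x ys)
    ≡⟨ map-∘ (insertions x ys) ⟩
      map (map f) (map (y ∷_) (insertions x ys))
    ∎)

  perms-map : ∀ f xs → perms (map f xs) ≡ map (map f) (perms xs)
  perms-map f [] = refl
  perms-map f (x ∷ xs) = begin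
      concatMap (insertions (f x)) (perms (map f xs))
    ≡⟨ cong (concatMap (insertions (f x))) (perms-map f xs) ⟩
      concatMap (insertions (f x)) (map (map f) (perms xs))
    ≡⟨ concatMap-map (insertions (f x)) (map f) (perms xs) ⟩
      concatMap (λ ys → insertions (f x) (map f ys)) (perms xs)
    ≡⟨ concatMap-cong (insertions-map f x) (perms xs) ⟩
      concatMap (map (map f) ∘ insertions x) (perms xs)
    ≡⟨ map-concatMap (map f) (insertions x) (perms xs) ⟨
      map (map f) (perms (x ∷ xs))
    ∎

  descWord-map-suc : ∀ p → descWord (map suc p) ≡ descWord p
  descWord-map-suc [] = refl
  descWord-map-suc (x ∷ []) = refl
  descWord-map-suc (x ∷ y ∷ p) = cong ((y <ᵇ x) ∷_) (descWord-map-suc (y ∷ p))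

  descWords-insertZero : ∀ y r → map descWord (insertions 0 (map suc (y ∷ r))) ≡ insertMinWords (descWord (y ∷ r))
  descWords-insertZero y r = cong₂ _∷_ (cong (a ∷_) (descWord-map-suc (y ∷ r))) (inner y r)
    where
      shift : ∀ y z ps → map descWord (map (suc y ∷_) (map (suc z ∷_) ps)) ≡
                         map ((z <ᵇ y) ∷_) (map descWord (map (suc z ∷_) ps))
      shift y z [] = refl
      shift y z (p ∷ ps) = cong (_ ∷_) (shift y z ps)
      inner : ∀ y r →
              map descWord (map (suc y ∷_) (insertions 0 (map suc r))) ≡ insertInnerWords (descWord (y ∷ r))
      inner y [] = refl
      inner y (z ∷ r) = cong₂ _∷_ (cong (λ w → b ∷ a ∷ w) (descWord-map-suc (z ∷ r)))
        (trans (shift y z (insertions 0 (map suc r))) (cong (map ((z <ᵇ y) ∷_)) (inner z r)))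

  concatMap-perms-cong : ∀ {f g : List ℕ → List Word} → (∀ y r → f (y ∷ r) ≡ g (y ∷ r)) →
                         ∀ x xs → concatMap f (perms (x ∷ xs)) ≡ concatMap g (perms (x ∷ xs))
  concatMap-perms-cong {f} {g} f≐g x xs = go (perms xs)
    where
      onInsertions : ∀ q → concatMap f (insertions x q) ≡ concatMap g (insertions x q)
      onInsertions [] = cong (_++ []) (f≐g x [])
      onInsertions (y ∷ ys) = cong₂ _++_ (f≐g x (y ∷ ys)) (begin
          concatMap f (map (y ∷_) (insertions x ys))
        ≡⟨ concatMap-map f (y ∷_) (insertions x ys) ⟩
          concatMap (f ∘ (y ∷_)) (insertions x ys)
        ≡⟨ concatMap-cong (f≐g y) (insertions x ys) ⟩
          concatMap (g ∘ (y ∷_)) (insertions x ys)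
        ≡⟨ concatMap-map g (y ∷_) (insertions x ys) ⟨
          concatMap g (map (y ∷_) (insertions x ys))
        ∎)
      go : ∀ qs → concatMap f (concatMap (insertions x) qs) ≡ concatMap g (concatMap (insertions x) qs)
      go [] = refl
      go (q ∷ qs) = begin
          concatMap f (insertions x q ++ concatMap (insertions x) qs)
        ≡⟨ concatMap-++ f (insertions x q) (concatMap (insertions x) qs) ⟩
          concatMap f (insertions x q) ++ concatMap f (concatMap (insertions x) qs)
        ≡⟨ cong₂ _++_ (onInsertions q) (go qs) ⟩
          concatMap g (insertions x q) ++ concatMap g (concatMap (insertions x) qs)
        ≡⟨ concatMap-++ g (insertions x q) (concatMap (insertions x) qs) ⟨
          concatMap g (insertions x q ++ concatMap (insertions x) qs)
        ∎

  descWords : ℕ → List Word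
  descWords n = map descWord (perms (upTo (suc n)))

  -- The permutations of 0, …, n + 1 arise by inserting 0 into those of 1, …, n + 1.
  descWords-suc : ∀ n → descWords (suc n) ≡ concatMap insertMinWords (descWords n)
  descWords-suc n = begin
      map descWord (perms (0 ∷ applyUpTo suc (suc n)))
    ≡⟨ cong (λ xs → map descWord (perms (0 ∷ xs))) (map-applyUpTo (λ x → x) suc (suc n)) ⟨
      map descWord (concatMap (insertions 0) (perms (map suc ns)))
    ≡⟨ cong (λ ps → map descWord (concatMap (insertions 0) ps)) (perms-map suc ns) ⟩
      map descWord (concatMap (insertions 0) (map (map suc) (perms ns)))
    ≡⟨ cong (map descWord) (concatMap-map (insertions 0) (map suc) (perms ns)) ⟩
      map descWord (concatMap (insertions 0 ∘ map suc) (perms ns))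
    ≡⟨ map-concatMap descWord (insertions 0 ∘ map suc) (perms ns) ⟩
      concatMap (map descWord ∘ insertions 0 ∘ map suc) (perms ns)
    ≡⟨ concatMap-perms-cong descWords-insertZero 0 (applyUpTo suc n) ⟩
      concatMap (insertMinWords ∘ descWord) (perms ns)
    ≡⟨ concatMap-map insertMinWords descWord (perms ns) ⟨
      concatMap insertMinWords (descWords n)
    ∎
    where
      ns : List ℕ
      ns = upTo (suc n)

  countW-descWords : ∀ n w → countW w (descWords n) ≡ descentCount n w
  countW-descWords zero [] = refl
  countW-descWords zero (_ ∷ _) = refl
  countW-descWords (suc n) w = begin
      countW w (descWords (suc n))
    ≡⟨ cong (countW w) (descWords-suc n) ⟩
      countW w (concatMap insertMinWords (descWords n))
    ≡⟨ countW-concatMap-insertMinWords (descWords n) w ⟩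
      insertMin (λ u → countW u (descWords n)) w
    ≡⟨ insertMin-cong (countW-descWords n) w ⟩
      descentCount (suc n) w
    ∎

module CdWords where
  open import Data.Bool using (if_then_else_)
  open import Data.Empty using (⊥-elim)
  open import Data.Nat as ℕ using (ℕ; zero; suc)
  import Data.Nat.Properties as ℕ
  open import Data.Integer using (ℤ; +_; _+_; _*_; _-_)
  open import Data.Integer.Properties using (+-identityʳ; *-identityʳ; *-zeroʳ; +-inverseʳ; *-commutativeSemigroup)
  open import Algebra.Properties.CommutativeSemigroup *-commutativeSemigroup using (xy∙z≈xz∙y)
  open import Data.Integer.Tactic.RingSolver using (solve-∀)
  import Data.Nat.Tactic.RingSolver as ℕ-Solver
  open import Data.Nat.ListAction using (sum)
  open import Data.List using (map; concatMap)
  open import Data.List.Properties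
    using (≡-dec; map-∘; map-id; ++-identityʳ; concatMap-++; concatMap-map; concatMap-cong; map-concatMap)
  open import Data.List.NonEmpty using (_∷_)
  open import Data.Product using (_,_)
  open import Relation.Binary.Definitions using (DecidableEquality)
  open import Relation.Nullary using (Dec; yes; no; does)
  open DescentWords using (countW-++; countW-[]-map; countW-map-∷; countW-map-∷-≢)
  open ≡-Reasoning

  data CD : Set where
    c d : CD

  _≟ᶜᵈ_ : DecidableEquality CD
  c ≟ᶜᵈ c = yes refl
  c ≟ᶜᵈ d = no (λ ())
  d ≟ᶜᵈ c = no (λ ())
  d ≟ᶜᵈ d = yes refl

  δ : List CD → List CD → ℤ
  δ U V = if does (≡-dec _≟ᶜᵈ_ U V) then + 1 else + 0

  degree : List CD → ℕ
  degree [] = 0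
  degree (c ∷ U) = suc (degree U)
  degree (d ∷ U) = suc (suc (degree U))

  cdWordL : ℕ → List ℕ → List CD
  cdWordL (suc x) xs = c ∷ cdWordL x xs
  cdWordL zero [] = []
  cdWordL zero (y ∷ ys) = d ∷ cdWordL y ys

  cdWord : CdMon → List CD
  cdWord (x ∷ xs) = cdWordL x xs

  degree-cdWord : ∀ u → degree (cdWord u) ≡ deg u
  degree-cdWord (x ∷ xs) = go x xs
    where
      arith : ∀ s l → suc (suc (s ℕ.+ 2 ℕ.* l)) ≡ s ℕ.+ 2 ℕ.* suc l
      arith = ℕ-Solver.solve-∀
      go : ∀ x xs → degree (cdWordL x xs) ≡ deg (x ∷ xs)
      go (suc x) xs = cong suc (go x xs)
      go zero [] = refl
      go zero (y ∷ ys) = trans (cong (λ n → suc (suc n)) (go y ys)) (arith (y ℕ.+ sum ys) (length ys))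

  incrementHead : List ℕ → List ℕ
  incrementHead [] = []
  incrementHead (x ∷ xs) = suc x ∷ xs

  fromCdWord : List CD → List ℕ
  fromCdWord [] = 0 ∷ []
  fromCdWord (c ∷ U) = incrementHead (fromCdWord U)
  fromCdWord (d ∷ U) = 0 ∷ fromCdWord U

  fromCdWord-cdWordL : ∀ x xs → fromCdWord (cdWordL x xs) ≡ x ∷ xs
  fromCdWord-cdWordL (suc x) xs = cong incrementHead (fromCdWord-cdWordL x xs)
  fromCdWord-cdWordL zero [] = refl
  fromCdWord-cdWordL zero (y ∷ ys) = cong (0 ∷_) (fromCdWord-cdWordL y ys)

  ≟ᵐ-δ : ∀ k u v → (if u ≟ᵐ v then k else + 0) ≡ k * δ (cdWord v) (cdWord u)
  ≟ᵐ-δ k (x ∷ xs) (y ∷ ys) =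
    agree (≡-dec ℕ._≟_ (x ∷ xs) (y ∷ ys)) (≡-dec _≟ᶜᵈ_ (cdWordL y ys) (cdWordL x xs))
    where
      agree : (p : Dec (x ∷ xs ≡ y ∷ ys)) (q : Dec (cdWordL y ys ≡ cdWordL x xs)) →
              (if does p then k else + 0) ≡ k * (if does q then + 1 else + 0)
      agree (yes _) (yes _) = sym (*-identityʳ k)
      agree (no _) (no _) = sym (*-zeroʳ k)
      agree (yes refl) (no ≢) = ⊥-elim (≢ refl)
      agree (no ≢) (yes ≡) = ⊥-elim (≢ (begin
          x ∷ xs                    ≡⟨ fromCdWord-cdWordL x xs ⟨
          fromCdWord (cdWordL x xs) ≡⟨ cong fromCdWord ≡ ⟨
          fromCdWord (cdWordL y ys) ≡⟨ fromCdWord-cdWordL y ys ⟩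
          y ∷ ys                    ∎))

  repeatHead : Word → Word
  repeatHead [] = a ∷ []
  repeatHead (x ∷ w) = x ∷ x ∷ w

  length-repeatHead : ∀ w → length (repeatHead w) ≡ suc (length w)
  length-repeatHead [] = refl
  length-repeatHead (x ∷ w) = refl

  -- coeffOf U f is the coefficient of U in f whenever f is the ab-expansion of a cd-polynomial: only a
  -- leading c yields words starting with a repeated letter, and a leading c yields a b w and b b w
  -- equally often, while a leading d yields only a b w.
  coeffOf : List CD → (Word → ℤ) → ℤ
  coeffOf [] f = f []
  coeffOf (c ∷ U) f = coeffOf U (λ w → f (repeatHead w))
  coeffOf (d ∷ U) f = coeffOf U (λ w → f (a ∷ b ∷ w) - f (b ∷ b ∷ w))

  record IsLinear (φ : (Word → ℤ) → ℤ) : Set where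
    field
      ≗-cong : ∀ {f g} → (∀ w → f w ≡ g w) → φ f ≡ φ g
      linear : ∀ k f g → φ (λ w → k * f w + g w) ≡ k * φ f + φ g
      preserves-0 : φ (λ _ → + 0) ≡ + 0

    homogeneous : ∀ k f → φ (λ w → k * f w) ≡ k * φ f
    homogeneous k f = begin
        φ (λ w → k * f w)          ≡⟨ ≗-cong (λ w → +-identityʳ (k * f w)) ⟨
        φ (λ w → k * f w + + 0)    ≡⟨ linear k f (λ _ → + 0) ⟩
        k * φ f + φ (λ _ → + 0)    ≡⟨ cong (_+_ (k * φ f)) preserves-0 ⟩
        k * φ f + + 0              ≡⟨ +-identityʳ (k * φ f) ⟩
        k * φ f                    ∎

    vanishing : ∀ {f} → (∀ w → f w ≡ + 0) → φ f ≡ + 0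
    vanishing f≐0 = trans (≗-cong f≐0) preserves-0

  coeffOf-congᴸ : ∀ U {f g} → (∀ w → length w ≡ degree U → f w ≡ g w) → coeffOf U f ≡ coeffOf U g
  coeffOf-congᴸ [] f≐g = f≐g [] refl
  coeffOf-congᴸ (c ∷ U) f≐g =
    coeffOf-congᴸ U (λ w e → f≐g (repeatHead w) (trans (length-repeatHead w) (cong suc e)))
  coeffOf-congᴸ (d ∷ U) f≐g = coeffOf-congᴸ U (λ w e →
    cong₂ _-_ (f≐g (a ∷ b ∷ w) (cong (λ n → suc (suc n)) e))
              (f≐g (b ∷ b ∷ w) (cong (λ n → suc (suc n)) e)))

  coeffOf-cong : ∀ U {f g} → (∀ w → f w ≡ g w) → coeffOf U f ≡ coeffOf U g
  coeffOf-cong U f≐g = coeffOf-congᴸ U (λ w _ → f≐g w)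

  coeffOf-linear : ∀ U k f g → coeffOf U (λ w → k * f w + g w) ≡ k * coeffOf U f + coeffOf U g
  coeffOf-linear [] k f g = refl
  coeffOf-linear (c ∷ U) k f g = coeffOf-linear U k (λ w → f (repeatHead w)) (λ w → g (repeatHead w))
  coeffOf-linear (d ∷ U) k f g = trans
    (coeffOf-cong U (λ w → distrib k (f (a ∷ b ∷ w)) (g (a ∷ b ∷ w)) (f (b ∷ b ∷ w)) (g (b ∷ b ∷ w))))
    (coeffOf-linear U k (λ w → f (a ∷ b ∷ w) - f (b ∷ b ∷ w)) (λ w → g (a ∷ b ∷ w) - g (b ∷ b ∷ w)))
    where
      distrib : ∀ k x y z t → k * x + y - (k * z + t) ≡ k * (x - z) + (y - t)
      distrib = solve-∀

  coeffOf-0 : ∀ U → coeffOf U (λ _ → + 0) ≡ + 0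
  coeffOf-0 [] = refl
  coeffOf-0 (c ∷ U) = coeffOf-0 U
  coeffOf-0 (d ∷ U) = coeffOf-0 U

  coeffOf-isLinear : ∀ U → IsLinear (coeffOf U)
  coeffOf-isLinear U = record
    { ≗-cong = coeffOf-cong U
    ; linear = coeffOf-linear U
    ; preserves-0 = coeffOf-0 U
    }

  module CoeffOf U = IsLinear (coeffOf-isLinear U)

  coeffOf-⊗ : ∀ U V k f g → coeffOf U (λ u → coeffOf V (λ v → k * f u * g v)) ≡ k * coeffOf U f * coeffOf V g
  coeffOf-⊗ U V k f g = begin
      coeffOf U (λ u → coeffOf V (λ v → k * f u * g v))
    ≡⟨ CoeffOf.≗-cong U (λ u → CoeffOf.homogeneous V (k * f u) g) ⟩
      coeffOf U (λ u → k * f u * coeffOf V g)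
    ≡⟨ CoeffOf.≗-cong U (λ u → xy∙z≈xz∙y k (f u) (coeffOf V g)) ⟩
      coeffOf U (λ u → k * coeffOf V g * f u)
    ≡⟨ CoeffOf.homogeneous U (k * coeffOf V g) f ⟩
      k * coeffOf V g * coeffOf U f
    ≡⟨ xy∙z≈xz∙y k (coeffOf V g) (coeffOf U f) ⟩
      k * coeffOf U f * coeffOf V g
    ∎

  expansionCount : List CD → Word → ℕ
  expansionCount [] [] = 1
  expansionCount [] (_ ∷ _) = 0
  expansionCount (c ∷ V) [] = 0
  expansionCount (c ∷ V) (_ ∷ w) = expansionCount V w
  expansionCount (d ∷ V) (a ∷ b ∷ w) = expansionCount V w
  expansionCount (d ∷ V) (b ∷ a ∷ w) = expansionCount V w
  expansionCount (d ∷ V) _ = 0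

  abExpansion : List CD → Word → ℤ
  abExpansion V w = + expansionCount V w

  coeffOf-abExpansion : ∀ U V → coeffOf U (abExpansion V) ≡ δ U V
  coeffOf-abExpansion [] [] = refl
  coeffOf-abExpansion [] (c ∷ V) = refl
  coeffOf-abExpansion [] (d ∷ V) = refl
  coeffOf-abExpansion (c ∷ U) [] = CoeffOf.vanishing U vanish
    where
      vanish : ∀ w → abExpansion [] (repeatHead w) ≡ + 0
      vanish [] = refl
      vanish (_ ∷ _) = refl
  coeffOf-abExpansion (c ∷ U) (c ∷ V) = trans (CoeffOf.≗-cong U shift) (coeffOf-abExpansion U V)
    where
      shift : ∀ w → abExpansion (c ∷ V) (repeatHead w) ≡ abExpansion V w
      shift [] = refl
      shift (_ ∷ _) = refl
  coeffOf-abExpansion (c ∷ U) (d ∷ V) = CoeffOf.vanishing U vanish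
    where
      vanish : ∀ w → abExpansion (d ∷ V) (repeatHead w) ≡ + 0
      vanish [] = refl
      vanish (a ∷ _) = refl
      vanish (b ∷ _) = refl
  coeffOf-abExpansion (d ∷ U) [] = coeffOf-0 U
  coeffOf-abExpansion (d ∷ U) (c ∷ V) = CoeffOf.vanishing U (λ w → +-inverseʳ (abExpansion V (b ∷ w)))
  coeffOf-abExpansion (d ∷ U) (d ∷ V) =
    trans (CoeffOf.≗-cong U (λ w → cong +_ (ℕ.+-identityʳ (expansionCount V w)))) (coeffOf-abExpansion U V)

  expandCD : List CD → List Word
  expandCD [] = [] ∷ []
  expandCD (c ∷ V) = map (a ∷_) (expandCD V) ++ map (b ∷_) (expandCD V)
  expandCD (d ∷ V) = map (a ∷_) (map (b ∷_) (expandCD V)) ++ map (b ∷_) (map (a ∷_) (expandCD V))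

  ⊗-map : ∀ x P Q → map (x ∷_) P ⊗ Q ≡ map (x ∷_) (P ⊗ Q)
  ⊗-map x P Q = begin
      concatMap (λ p → map (p ++_) Q) (map (x ∷_) P)
    ≡⟨ concatMap-map (λ p → map (p ++_) Q) (x ∷_) P ⟩
      concatMap (λ p → map ((x ∷ p) ++_) Q) P
    ≡⟨ concatMap-cong (λ p → map-∘ Q) P ⟩
      concatMap (λ p → map (x ∷_) (map (p ++_) Q)) P
    ≡⟨ map-concatMap (x ∷_) (λ p → map (p ++_) Q) P ⟨
      map (x ∷_) (P ⊗ Q)
    ∎

  expandL-suc : ∀ x xs → expandL (suc x) xs ≡ map (a ∷_) (expandL x xs) ++ map (b ∷_) (expandL x xs)
  expandL-suc x [] = refl
  expandL-suc x (y ∷ ys) = trans (concatMap-++ (λ p → map (p ++_) Q) (map (a ∷_) A) (map (b ∷_) A))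
                                 (cong₂ _++_ (⊗-map a A Q) (⊗-map b A Q))
    where
      A Q : List Word
      A = allWords x
      Q = dWords ⊗ expandL y ys

  expandL-cdWordL : ∀ x xs → expandL x xs ≡ expandCD (cdWordL x xs)
  expandL-cdWordL (suc x) xs =
    trans (expandL-suc x xs) (cong (λ E → map (a ∷_) E ++ map (b ∷_) E) (expandL-cdWordL x xs))
  expandL-cdWordL zero [] = refl
  expandL-cdWordL zero (y ∷ ys) = begin
      map (λ q → q) (dWords ⊗ E) ++ []
    ≡⟨ trans (++-identityʳ _) (map-id (dWords ⊗ E)) ⟩
      map (λ q → a ∷ b ∷ q) E ++ (map (λ q → b ∷ a ∷ q) E ++ [])
    ≡⟨ cong₂ _++_ (map-∘ E) (trans (++-identityʳ _) (map-∘ E)) ⟩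
      map (a ∷_) (map (b ∷_) E) ++ map (b ∷_) (map (a ∷_) E)
    ≡⟨ cong (λ E → map (a ∷_) (map (b ∷_) E) ++ map (b ∷_) (map (a ∷_) E)) (expandL-cdWordL y ys) ⟩
      expandCD (cdWordL zero (y ∷ ys))
    ∎
    where
      E : List Word
      E = expandL y ys

  countW-expandCD : ∀ V w → countW w (expandCD V) ≡ expansionCount V w
  countW-expandCD [] [] = refl
  countW-expandCD [] (_ ∷ _) = refl
  countW-expandCD (c ∷ V) w = trans (countW-++ w (map (a ∷_) E) (map (b ∷_) E)) (split w)
    where
      E : List Word
      E = expandCD V
      split : ∀ w → countW w (map (a ∷_) E) ℕ.+ countW w (map (b ∷_) E) ≡ expansionCount (c ∷ V) w
      split [] = cong₂ ℕ._+_ (countW-[]-map a E) (countW-[]-map b E)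
      split (a ∷ w) = trans (cong₂ ℕ._+_ (countW-map-∷ a w E) (countW-map-∷-≢ b w E))
                            (trans (ℕ.+-identityʳ _) (countW-expandCD V w))
      split (b ∷ w) = trans (cong₂ ℕ._+_ (countW-map-∷-≢ a w E) (countW-map-∷ b w E)) (countW-expandCD V w)
  countW-expandCD (d ∷ V) w = trans (countW-++ w (map (a ∷_) Eb) (map (b ∷_) Ea)) (split w)
    where
      E Ea Eb : List Word
      E = expandCD V
      Ea = map (a ∷_) E
      Eb = map (b ∷_) E
      afterA : ∀ w → countW w Eb ≡ expansionCount (d ∷ V) (a ∷ w)
      afterA [] = countW-[]-map b E
      afterA (a ∷ w) = countW-map-∷-≢ b w E
      afterA (b ∷ w) = trans (countW-map-∷ b w E) (countW-expandCD V w)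
      afterB : ∀ w → countW w Ea ≡ expansionCount (d ∷ V) (b ∷ w)
      afterB [] = countW-[]-map a E
      afterB (a ∷ w) = trans (countW-map-∷ a w E) (countW-expandCD V w)
      afterB (b ∷ w) = countW-map-∷-≢ a w E
      split : ∀ w → countW w (map (a ∷_) Eb) ℕ.+ countW w (map (b ∷_) Ea) ≡ expansionCount (d ∷ V) w
      split [] = cong₂ ℕ._+_ (countW-[]-map a Eb) (countW-[]-map b Ea)
      split (a ∷ w) = trans (cong₂ ℕ._+_ (countW-map-∷ a w Eb) (countW-map-∷-≢ b w Ea))
                            (trans (ℕ.+-identityʳ _) (afterA w))
      split (b ∷ w) = trans (cong₂ ℕ._+_ (countW-map-∷-≢ a w Eb) (countW-map-∷ b w Ea)) (afterB w)

  countW-expand : ∀ u w → countW w (expand u) ≡ expansionCount (cdWord u) w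
  countW-expand (x ∷ xs) w = trans (cong (countW w) (expandL-cdWordL x xs)) (countW-expandCD (cdWordL x xs) w)

  linear-abCoeff-∷ : ∀ {φ} → IsLinear φ → ∀ k y q →
                     φ (abCoeff ((k , y) ∷ q)) ≡ k * φ (abExpansion (cdWord y)) + φ (abCoeff q)
  linear-abCoeff-∷ {φ} φ-linear k y q = begin
      φ (λ w → k * + countW w (expand y) + abCoeff q w)
    ≡⟨ linear k (λ w → + countW w (expand y)) (abCoeff q) ⟩
      k * φ (λ w → + countW w (expand y)) + φ (abCoeff q)
    ≡⟨ cong (λ x → k * x + φ (abCoeff q)) (≗-cong (λ w → cong +_ (countW-expand y w))) ⟩
      k * φ (abExpansion (cdWord y)) + φ (abCoeff q)
    ∎
    where open IsLinear φ-linear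

  linear-≡-on-abCoeff : ∀ {φ χ} → IsLinear φ → IsLinear χ →
                        (∀ y → φ (abExpansion (cdWord y)) ≡ χ (abExpansion (cdWord y))) →
                        ∀ q → φ (abCoeff q) ≡ χ (abCoeff q)
  linear-≡-on-abCoeff φ-linear χ-linear φ≡χ [] =
    trans (IsLinear.preserves-0 φ-linear) (sym (IsLinear.preserves-0 χ-linear))
  linear-≡-on-abCoeff φ-linear χ-linear φ≡χ ((k , y) ∷ q) =
    trans (linear-abCoeff-∷ φ-linear k y q)
          (trans (cong₂ (λ x z → k * x + z) (φ≡χ y) (linear-≡-on-abCoeff φ-linear χ-linear φ≡χ q))
                 (sym (linear-abCoeff-∷ χ-linear k y q)))

  cdCoeff-coeffOf : ∀ p v → cdCoeff p v ≡ coeffOf (cdWord v) (abCoeff p)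
  cdCoeff-coeffOf [] v = sym (coeffOf-0 (cdWord v))
  cdCoeff-coeffOf ((k , u) ∷ p) v = begin
      (if u ≟ᵐ v then k else + 0) + cdCoeff p v
    ≡⟨ cong₂ _+_ (≟ᵐ-δ k u v) (cdCoeff-coeffOf p v) ⟩
      k * δ (cdWord v) (cdWord u) + coeffOf (cdWord v) (abCoeff p)
    ≡⟨ cong (λ x → k * x + coeffOf (cdWord v) (abCoeff p)) (coeffOf-abExpansion (cdWord v) (cdWord u)) ⟨
      k * coeffOf (cdWord v) (abExpansion (cdWord u)) + coeffOf (cdWord v) (abCoeff p)
    ≡⟨ linear-abCoeff-∷ (coeffOf-isLinear (cdWord v)) k u p ⟨
      coeffOf (cdWord v) (abCoeff ((k , u) ∷ p))
    ∎

module ProductTerms where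
  open import Data.Nat using (ℕ; zero; suc; _+_; _*_)
  open import Data.Nat.ListAction using (sum)
  open import Data.Nat.Tactic.RingSolver using (solve-∀)
  open import Data.Integer using (ℤ)
  open import Data.List using (map)
  open import Data.List.NonEmpty using (_∷_; toList)
  open import Data.Product using (_×_; _,_; proj₂)
  open import Data.List.Relation.Unary.All as All using (All; []; _∷_)
  open import Data.List.Relation.Unary.All.Properties using (map⁺)
  open ≡-Reasoning

  prepend : ℕ → ℤ × CdMon → ℤ × CdMon
  prepend x (k , t) = k , (x ∷ toList t)

  ·-cons : ∀ x y ys v → (x ∷ y ∷ ys) · v ≡ map (prepend x) ((y ∷ ys) · v)
  ·-cons x y ys (n ∷ N) with unsnoc y ys
  ... | I , zero with n
  ...   | zero = refl
  ...   | suc _ = refl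
  ·-cons x y ys (n ∷ N) | I , suc l with n
  ...   | zero = refl
  ...   | suc _ = refl

  deg-∷ : ∀ x t → deg (x ∷ toList t) ≡ 2 + x + deg t
  deg-∷ x (h ∷ tl) = arith x h (sum tl) (length tl)
    where
      arith : ∀ x h s l → x + (h + s) + 2 * suc l ≡ 2 + x + (h + s + 2 * l)
      arith = solve-∀

  deg-dropLast : ∀ x n N → deg (x ∷ n ∷ N) ≡ deg (suc x ∷ []) + deg (n ∷ N) + 1
  deg-dropLast x n N = arith x n (sum N) (length N)
    where
      arith : ∀ x n s l → x + (n + s) + 2 * suc l ≡ suc x + 0 + 0 + (n + s + 2 * l) + 1
      arith = solve-∀

  deg-dropFirst : ∀ x n N → deg (x ∷ n ∷ N) ≡ deg (x ∷ []) + deg (suc n ∷ N) + 1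
  deg-dropFirst x n N = arith x n (sum N) (length N)
    where
      arith : ∀ x n s l → x + (n + s) + 2 * suc l ≡ x + 0 + 0 + (suc n + s + 2 * l) + 1
      arith = solve-∀

  deg-glue : ∀ x n N → deg ((x + n + 1) ∷ N) ≡ deg (x ∷ []) + deg (n ∷ N) + 1
  deg-glue x n N = arith x n (sum N) (length N)
    where
      arith : ∀ x n s l → x + n + 1 + s + 2 * l ≡ x + 0 + 0 + (n + s + 2 * l) + 1
      arith = solve-∀

  HasDegree : ℕ → CdPoly → Set
  HasDegree n = All (λ kt → deg (proj₂ kt) ≡ n)

  ·-degree : ∀ u v → HasDegree (deg u + deg v + 1) (u · v)
  ·-degree (x ∷ xs) = go x xs
    where
      regroup : ∀ p q r → p + (q + r + 1) ≡ p + q + r + 1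
      regroup = solve-∀
      go : ∀ x xs v → HasDegree (deg (x ∷ xs) + deg v + 1) ((x ∷ xs) · v)
      go zero [] (zero ∷ N) = deg-glue 0 0 N ∷ []
      go zero [] (suc n ∷ N) = deg-dropFirst 0 n N ∷ deg-glue 0 (suc n) N ∷ []
      go (suc x) [] (zero ∷ N) = deg-dropLast x 0 N ∷ deg-glue (suc x) 0 N ∷ []
      go (suc x) [] (suc n ∷ N) =
        deg-dropLast x (suc n) N ∷ deg-dropFirst (suc x) n N ∷ deg-glue (suc x) (suc n) N ∷ []
      go x (y ∷ ys) v =
        subst (HasDegree _) (sym (·-cons x y ys v)) (map⁺ (All.map (λ {kt} → shift {kt}) (go y ys v)))
        where
          shift : ∀ {kt} → deg (proj₂ kt) ≡ deg (y ∷ ys) + deg v + 1 →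
                  deg (proj₂ (prepend x kt)) ≡ deg (x ∷ y ∷ ys) + deg v + 1
          shift {k , t} e = begin
              deg (x ∷ toList t)
            ≡⟨ deg-∷ x t ⟩
              2 + x + deg t
            ≡⟨ cong (2 + x +_) e ⟩
              2 + x + (deg (y ∷ ys) + deg v + 1)
            ≡⟨ regroup (2 + x) (deg (y ∷ ys)) (deg v) ⟩
              2 + x + deg (y ∷ ys) + deg v + 1
            ≡⟨ cong (λ z → z + deg v + 1) (deg-∷ x (y ∷ ys)) ⟨
              deg (x ∷ y ∷ ys) + deg v + 1
            ∎

module CdProduct where
  open import Data.Nat as ℕ using (ℕ; zero; suc)
  import Data.Nat.Properties as ℕ
  open import Data.Integer using (ℤ; +_; _+_; _*_; _-_)
  open import Data.Nat.Combinatorics using (_C_)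
  open import Data.Integer.Properties using (+-identityˡ; +-identityʳ; *-identityˡ; *-zeroʳ; +-inverseʳ; pos-*)
  open import Data.Integer.Tactic.RingSolver using (solve-∀)
  open import Data.List using (map)
  open import Data.List.NonEmpty using (_∷_; toList)
  open import Data.Product using (_,_)
  open import Data.List.Relation.Unary.All using ([]; _∷_)
  open DescentCounts using (descentCount; cut; cut-descentCount)
  open CdWords
  open ProductTerms
  open ≡-Reasoning

  cutℤ : (Word → ℤ) → Word → Word → ℤ
  cutℤ f u v = f (u ++ a ∷ v) + f (u ++ b ∷ v)

  -- The coefficient of U ⊗ V in Δ f.
  coeffOf⊗ : List CD → List CD → (Word → ℤ) → ℤ
  coeffOf⊗ U V f = coeffOf U (λ u → coeffOf V (cutℤ f u))

  coeffOf⊗-isLinear : ∀ U V → IsLinear (coeffOf⊗ U V)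
  coeffOf⊗-isLinear U V = record
    { ≗-cong = λ f≐g → CoeffOf.≗-cong U (λ u → CoeffOf.≗-cong V (λ v →
                         cong₂ _+_ (f≐g (u ++ a ∷ v)) (f≐g (u ++ b ∷ v))))
    ; linear = linear
    ; preserves-0 = CoeffOf.vanishing U (λ _ → coeffOf-0 V)
    }
    where
      regroup : ∀ k x y z t → k * x + y + (k * z + t) ≡ k * (x + z) + (y + t)
      regroup = solve-∀
      linear : ∀ k f g → coeffOf⊗ U V (λ w → k * f w + g w) ≡ k * coeffOf⊗ U V f + coeffOf⊗ U V g
      linear k f g = begin
          coeffOf⊗ U V (λ w → k * f w + g w)
        ≡⟨ CoeffOf.≗-cong U (λ u → CoeffOf.≗-cong V (λ v →
             regroup k (f (u ++ a ∷ v)) (g (u ++ a ∷ v)) (f (u ++ b ∷ v)) (g (u ++ b ∷ v)))) ⟩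
          coeffOf U (λ u → coeffOf V (λ v → k * cutℤ f u v + cutℤ g u v))
        ≡⟨ CoeffOf.≗-cong U (λ u → coeffOf-linear V k (cutℤ f u) (cutℤ g u)) ⟩
          coeffOf U (λ u → k * coeffOf V (cutℤ f u) + coeffOf V (cutℤ g u))
        ≡⟨ coeffOf-linear U k _ _ ⟩
          k * coeffOf⊗ U V f + coeffOf⊗ U V g
        ∎

  -- The coefficient of Y in U · V = U⁻ d V + U d ⁻V + 2 U c V, where U⁻ is U without a final c and
  -- ⁻V is V without an initial c (the terms being absent otherwise), computed from the left.
  productCoeff : List CD → List CD → List CD → ℤ
  productCoeff U V [] = + 0
  productCoeff [] V (c ∷ Y) = + 2 * δ V Y
  productCoeff [] V (d ∷ Y) = δ V (c ∷ Y)
  productCoeff (c ∷ U) V (c ∷ Y) = productCoeff U V Y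
  productCoeff (c ∷ []) V (d ∷ Y) = δ V Y
  productCoeff (c ∷ _ ∷ _) V (d ∷ Y) = + 0
  productCoeff (d ∷ U) V (c ∷ Y) = + 0
  productCoeff (d ∷ U) V (d ∷ Y) = productCoeff U V Y

  coeffOf-∷-vanishing : ∀ x U {f} → (∀ y w → f (y ∷ w) ≡ + 0) → coeffOf (x ∷ U) f ≡ + 0
  coeffOf-∷-vanishing c U {f} f≐0 = CoeffOf.vanishing U vanish
    where
      vanish : ∀ w → f (repeatHead w) ≡ + 0
      vanish [] = f≐0 a []
      vanish (y ∷ w) = f≐0 y (y ∷ w)
  coeffOf-∷-vanishing d U f≐0 = CoeffOf.vanishing U (λ w → cong₂ _-_ (f≐0 a (b ∷ w)) (f≐0 b (b ∷ w)))

  coeffOf⊗-abExpansion : ∀ U V Y → coeffOf⊗ U V (abExpansion Y) ≡ productCoeff U V Y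
  coeffOf⊗-abExpansion U V [] =
    CoeffOf.vanishing U (λ u → CoeffOf.vanishing V (λ v → cong₂ _+_ (nonempty u a v) (nonempty u b v)))
    where
      nonempty : ∀ u x v → abExpansion [] (u ++ x ∷ v) ≡ + 0
      nonempty [] x v = refl
      nonempty (_ ∷ _) x v = refl
  coeffOf⊗-abExpansion [] V (c ∷ Y) = begin
      coeffOf V (λ v → abExpansion Y v + abExpansion Y v)
    ≡⟨ CoeffOf.≗-cong V (λ v → x+x≡2x (abExpansion Y v)) ⟩
      coeffOf V (λ v → + 2 * abExpansion Y v)
    ≡⟨ CoeffOf.homogeneous V (+ 2) (abExpansion Y) ⟩
      + 2 * coeffOf V (abExpansion Y)
    ≡⟨ cong (_*_ (+ 2)) (coeffOf-abExpansion V Y) ⟩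
      + 2 * δ V Y
    ∎
    where
      x+x≡2x : ∀ x → x + x ≡ + 2 * x
      x+x≡2x = solve-∀
  coeffOf⊗-abExpansion [] V (d ∷ Y) = trans (CoeffOf.≗-cong V shift) (coeffOf-abExpansion V (c ∷ Y))
    where
      shift : ∀ v → abExpansion (d ∷ Y) (a ∷ v) + abExpansion (d ∷ Y) (b ∷ v) ≡ abExpansion (c ∷ Y) v
      shift [] = refl
      shift (a ∷ v) = refl
      shift (b ∷ v) = cong +_ (ℕ.+-identityʳ (expansionCount Y v))
  coeffOf⊗-abExpansion (c ∷ U) V (c ∷ Y) = trans (CoeffOf.≗-cong U shift) (coeffOf⊗-abExpansion U V Y)
    where
      shift : ∀ u → coeffOf V (cutℤ (abExpansion (c ∷ Y)) (repeatHead u)) ≡ coeffOf V (cutℤ (abExpansion Y) u)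
      shift [] = refl
      shift (_ ∷ _) = refl
  coeffOf⊗-abExpansion (c ∷ []) V (d ∷ Y) = coeffOf-abExpansion V Y
  coeffOf⊗-abExpansion (c ∷ x ∷ U) V (d ∷ Y) = coeffOf-∷-vanishing x U vanish
    where
      vanish : ∀ y w → coeffOf V (cutℤ (abExpansion (d ∷ Y)) (y ∷ y ∷ w)) ≡ + 0
      vanish a w = coeffOf-0 V
      vanish b w = coeffOf-0 V
  coeffOf⊗-abExpansion (d ∷ U) V (c ∷ Y) = CoeffOf.vanishing U (λ w → +-inverseʳ (cutY (b ∷ w)))
    where
      cutY : Word → ℤ
      cutY u = coeffOf V (cutℤ (abExpansion Y) u)
  coeffOf⊗-abExpansion (d ∷ U) V (d ∷ Y) =
    trans (CoeffOf.≗-cong U (λ w → trans (cong (_-_ (cutY w)) (coeffOf-0 V)) (+-identityʳ (cutY w))))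
          (coeffOf⊗-abExpansion U V Y)
    where
      cutY : Word → ℤ
      cutY u = coeffOf V (cutℤ (abExpansion Y) u)

  coeffᶜᵈ : CdPoly → List CD → ℤ
  coeffᶜᵈ [] Y = + 0
  coeffᶜᵈ ((k , t) ∷ p) Y = k * δ (cdWord t) Y + coeffᶜᵈ p Y

  coeffᶜᵈ-prepend-c : ∀ x p Y → coeffᶜᵈ (map (prepend (suc x)) p) (c ∷ Y) ≡ coeffᶜᵈ (map (prepend x) p) Y
  coeffᶜᵈ-prepend-c x [] Y = refl
  coeffᶜᵈ-prepend-c x ((k , t) ∷ p) Y = cong (_+_ (k * δ (cdWord (x ∷ toList t)) Y)) (coeffᶜᵈ-prepend-c x p Y)

  coeffᶜᵈ-prepend-d : ∀ p Y → coeffᶜᵈ (map (prepend 0) p) (d ∷ Y) ≡ coeffᶜᵈ p Y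
  coeffᶜᵈ-prepend-d [] Y = refl
  coeffᶜᵈ-prepend-d ((k , t) ∷ p) Y = cong (_+_ (k * δ (cdWord t) Y)) (coeffᶜᵈ-prepend-d p Y)

  coeffᶜᵈ-prepend-≢ : ∀ x p Y → (∀ t → δ (cdWord (x ∷ toList t)) Y ≡ + 0) →
                      coeffᶜᵈ (map (prepend x) p) Y ≡ + 0
  coeffᶜᵈ-prepend-≢ x [] Y δ≡0 = refl
  coeffᶜᵈ-prepend-≢ x ((k , t) ∷ p) Y δ≡0 =
    cong₂ _+_ (trans (cong (_*_ k) (δ≡0 t)) (*-zeroʳ k)) (coeffᶜᵈ-prepend-≢ x p Y δ≡0)

  coeffᶜᵈ-·-single : ∀ x v Y → coeffᶜᵈ ((x ∷ []) · v) Y ≡ productCoeff (cdWordL x []) (cdWord v) Y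
  coeffᶜᵈ-·-single zero (zero ∷ N) [] = refl
  coeffᶜᵈ-·-single zero (zero ∷ N) (c ∷ Y) = +-identityʳ _
  coeffᶜᵈ-·-single zero (zero ∷ []) (d ∷ Y) = refl
  coeffᶜᵈ-·-single zero (zero ∷ _ ∷ _) (d ∷ Y) = refl
  coeffᶜᵈ-·-single zero (suc n ∷ N) [] = refl
  coeffᶜᵈ-·-single zero (suc n ∷ N) (c ∷ Y) = begin
      + 0 + (+ 2 * δ (cdWordL (n ℕ.+ 1) N) Y + + 0)
    ≡⟨ trans (+-identityˡ _) (+-identityʳ _) ⟩
      + 2 * δ (cdWordL (n ℕ.+ 1) N) Y
    ≡⟨ cong (λ j → + 2 * δ (cdWordL j N) Y) (ℕ.+-comm n 1) ⟩
      + 2 * δ (cdWordL (suc n) N) Y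
    ∎
  coeffᶜᵈ-·-single zero (suc n ∷ N) (d ∷ Y) = trans (+-identityʳ _) (*-identityˡ _)
  coeffᶜᵈ-·-single (suc zero) (zero ∷ N) [] = refl
  coeffᶜᵈ-·-single (suc zero) (suc n ∷ N) [] = refl
  coeffᶜᵈ-·-single (suc (suc x)) (zero ∷ N) [] = refl
  coeffᶜᵈ-·-single (suc (suc x)) (suc n ∷ N) [] = refl
  coeffᶜᵈ-·-single (suc zero) v@(zero ∷ N) (c ∷ Y) = trans (+-identityˡ _) (coeffᶜᵈ-·-single zero v Y)
  coeffᶜᵈ-·-single (suc zero) v@(suc n ∷ N) (c ∷ Y) = trans (+-identityˡ _) (coeffᶜᵈ-·-single zero v Y)
  coeffᶜᵈ-·-single (suc (suc x)) (zero ∷ N) (c ∷ Y) = coeffᶜᵈ-·-single (suc x) (zero ∷ N) Y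
  coeffᶜᵈ-·-single (suc (suc x)) (suc n ∷ N) (c ∷ Y) = coeffᶜᵈ-·-single (suc x) (suc n ∷ N) Y
  coeffᶜᵈ-·-single (suc zero) (zero ∷ N) (d ∷ Y) = trans (+-identityʳ _) (*-identityˡ _)
  coeffᶜᵈ-·-single (suc zero) (suc n ∷ N) (d ∷ Y) = trans (+-identityʳ _) (*-identityˡ _)
  coeffᶜᵈ-·-single (suc (suc x)) (zero ∷ N) (d ∷ Y) = refl
  coeffᶜᵈ-·-single (suc (suc x)) (suc n ∷ N) (d ∷ Y) = refl

  coeffᶜᵈ-· : ∀ u v Y → coeffᶜᵈ (u · v) Y ≡ productCoeff (cdWord u) (cdWord v) Y
  coeffᶜᵈ-· (x ∷ []) v Y = coeffᶜᵈ-·-single x v Y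
  coeffᶜᵈ-· (x ∷ y ∷ ys) v Y = trans (cong (λ p → coeffᶜᵈ p Y) (·-cons x y ys v)) (prefixed x Y)
    where
      P : CdPoly
      P = (y ∷ ys) · v
      prefixed : ∀ x Y → coeffᶜᵈ (map (prepend x) P) Y ≡ productCoeff (cdWordL x (y ∷ ys)) (cdWord v) Y
      prefixed zero [] = coeffᶜᵈ-prepend-≢ zero P [] (λ _ → refl)
      prefixed zero (c ∷ Y) = coeffᶜᵈ-prepend-≢ zero P (c ∷ Y) (λ _ → refl)
      prefixed zero (d ∷ Y) = trans (coeffᶜᵈ-prepend-d P Y) (coeffᶜᵈ-· (y ∷ ys) v Y)
      prefixed (suc x) [] = coeffᶜᵈ-prepend-≢ (suc x) P [] (λ _ → refl)
      prefixed (suc x) (c ∷ Y) = trans (coeffᶜᵈ-prepend-c x P Y) (prefixed x Y)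
      prefixed (suc zero) (d ∷ Y) = coeffᶜᵈ-prepend-≢ (suc zero) P (d ∷ Y) (λ _ → refl)
      prefixed (suc (suc x)) (d ∷ Y) = coeffᶜᵈ-prepend-≢ (suc (suc x)) P (d ∷ Y) (λ _ → refl)

  coeffOfPoly : CdPoly → (Word → ℤ) → ℤ
  coeffOfPoly [] f = + 0
  coeffOfPoly ((k , t) ∷ p) f = k * coeffOf (cdWord t) f + coeffOfPoly p f

  coeffOfPoly-isLinear : ∀ p → IsLinear (coeffOfPoly p)
  coeffOfPoly-isLinear p = record { ≗-cong = ≗-cong p ; linear = linear p ; preserves-0 = preserves-0 p }
    where
      ≗-cong : ∀ p {f g} → (∀ w → f w ≡ g w) → coeffOfPoly p f ≡ coeffOfPoly p g
      ≗-cong [] f≐g = refl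
      ≗-cong ((k , t) ∷ p) f≐g = cong₂ _+_ (cong (_*_ k) (CoeffOf.≗-cong (cdWord t) f≐g)) (≗-cong p f≐g)
      regroup : ∀ k′ k x y z t → k′ * (k * x + y) + (k * z + t) ≡ k * (k′ * x + z) + (k′ * y + t)
      regroup = solve-∀
      linear : ∀ p k f g → coeffOfPoly p (λ w → k * f w + g w) ≡ k * coeffOfPoly p f + coeffOfPoly p g
      linear [] k f g = sym (trans (+-identityʳ _) (*-zeroʳ k))
      linear ((k′ , t) ∷ p) k f g =
        trans (cong₂ _+_ (cong (_*_ k′) (coeffOf-linear (cdWord t) k f g)) (linear p k f g))
              (regroup k′ k (coeffOf (cdWord t) f) (coeffOf (cdWord t) g) (coeffOfPoly p f) (coeffOfPoly p g))
      preserves-0 : ∀ p → coeffOfPoly p (λ _ → + 0) ≡ + 0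
      preserves-0 [] = refl
      preserves-0 ((k , t) ∷ p) = cong₂ _+_ (trans (cong (_*_ k) (coeffOf-0 (cdWord t))) (*-zeroʳ k)) (preserves-0 p)

  coeffOfPoly-abExpansion : ∀ p Y → coeffOfPoly p (abExpansion Y) ≡ coeffᶜᵈ p Y
  coeffOfPoly-abExpansion [] Y = refl
  coeffOfPoly-abExpansion ((k , t) ∷ p) Y =
    cong₂ _+_ (cong (_*_ k) (coeffOf-abExpansion (cdWord t) Y)) (coeffOfPoly-abExpansion p Y)

  coeffOfPoly-· : ∀ u v q → coeffOfPoly (u · v) (abCoeff q) ≡ coeffOf⊗ (cdWord u) (cdWord v) (abCoeff q)
  coeffOfPoly-· u v =
    linear-≡-on-abCoeff (coeffOfPoly-isLinear (u · v)) (coeffOf⊗-isLinear (cdWord u) (cdWord v)) onMonomials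
    where
      onMonomials : ∀ y → coeffOfPoly (u · v) (abExpansion (cdWord y)) ≡
                          coeffOf⊗ (cdWord u) (cdWord v) (abExpansion (cdWord y))
      onMonomials y = begin
          coeffOfPoly (u · v) (abExpansion (cdWord y))
        ≡⟨ coeffOfPoly-abExpansion (u · v) (cdWord y) ⟩
          coeffᶜᵈ (u · v) (cdWord y)
        ≡⟨ coeffᶜᵈ-· u v (cdWord y) ⟩
          productCoeff (cdWord u) (cdWord v) (cdWord y)
        ≡⟨ coeffOf⊗-abExpansion (cdWord u) (cdWord v) (cdWord y) ⟨
          coeffOf⊗ (cdWord u) (cdWord v) (abExpansion (cdWord y))
        ∎

  βP-coeffOfPoly : ∀ ψ n p → HasDegree n p → βP ψ p ≡ coeffOfPoly p (abCoeff (ψ n))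
  βP-coeffOfPoly ψ n [] [] = refl
  βP-coeffOfPoly ψ n ((k , t) ∷ p) (deg-t ∷ degs) = cong₂ _+_
    (cong (_*_ k) (trans (cdCoeff-coeffOf (ψ (deg t)) t) (cong (λ m → coeffOf (cdWord t) (abCoeff (ψ m))) deg-t)))
    (βP-coeffOfPoly ψ n p degs)

  ΨB : ℕ → Word → ℤ
  ΨB n w = + descentCount n w

  coeffOf⊗-ΨB : ∀ {m k} U V → degree U ≡ m → degree V ≡ k →
                coeffOf⊗ U V (ΨB (m ℕ.+ k ℕ.+ 1)) ≡
                + ((m ℕ.+ k ℕ.+ 2) C (m ℕ.+ 1)) * coeffOf U (ΨB m) * coeffOf V (ΨB k)
  coeffOf⊗-ΨB {m} {k} U V degU degV = trans
    (coeffOf-congᴸ U (λ u |u| → coeffOf-congᴸ V (λ v |v| → cutℤ-ΨB u v (trans |u| degU) (trans |v| degV))))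
    (coeffOf-⊗ U V (+ binomial) (ΨB m) (ΨB k))
    where
      binomial : ℕ
      binomial = (m ℕ.+ k ℕ.+ 2) C (m ℕ.+ 1)
      cutℤ-ΨB : ∀ u v → length u ≡ m → length v ≡ k →
                cutℤ (ΨB (m ℕ.+ k ℕ.+ 1)) u v ≡ + binomial * ΨB m u * ΨB k v
      cutℤ-ΨB u v |u| |v| = begin
          + cut (descentCount (m ℕ.+ k ℕ.+ 1)) u v
        ≡⟨ cong (λ n → + cut (descentCount n) u v) (ℕ.+-comm (m ℕ.+ k) 1) ⟩
          + cut (descentCount (suc (m ℕ.+ k))) u v
        ≡⟨ cong +_ (cut-descentCount (m ℕ.+ k) u v |u| |v| refl) ⟩
          + ((suc (suc (m ℕ.+ k)) C suc m) ℕ.* descentCount m u ℕ.* descentCount k v)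
        ≡⟨ cong₂ (λ n j → + ((n C j) ℕ.* descentCount m u ℕ.* descentCount k v))
                 (ℕ.+-comm 2 (m ℕ.+ k)) (ℕ.+-comm 1 m) ⟩
          + (binomial ℕ.* descentCount m u ℕ.* descentCount k v)
        ≡⟨ pos-* (binomial ℕ.* descentCount m u) (descentCount k v) ⟩
          + (binomial ℕ.* descentCount m u) * ΨB k v
        ≡⟨ cong (_* ΨB k v) (pos-* binomial (descentCount m u)) ⟩
          + binomial * ΨB m u * ΨB k v
        ∎

open import Data.Nat using (ℕ; _+_)
open import Data.Nat.Combinatorics using (_C_)
open import Data.Integer using (+_; _*_)
open ≡-Reasoning
open DescentWords using (countW-descWords)
open CdWords
open ProductTerms using (·-degree)
open CdProduct

abCoeff-cdIndex : ∀ n q → IsCdIndexB n q → ∀ w → abCoeff q w ≡ ΨB n w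
abCoeff-cdIndex n q q-cdIndex w = trans (q-cdIndex w) (cong +_ (countW-descWords n w))

β-coeffOf : ∀ ψ → (∀ n → IsCdIndexB n (ψ n)) → ∀ u → β ψ u ≡ coeffOf (cdWord u) (ΨB (deg u))
β-coeffOf ψ ψ-cdIndex u = trans (cdCoeff-coeffOf (ψ (deg u)) u)
                                (CoeffOf.≗-cong (cdWord u) (abCoeff-cdIndex (deg u) (ψ (deg u)) (ψ-cdIndex (deg u))))

lemma3p4 : (ψ : ℕ → CdPoly) → (∀ n → IsCdIndexB n (ψ n)) →
           ∀ (u v : CdMon) →
           βP ψ (u · v) ≡ (+ ((deg u + deg v + 2) C (deg u + 1))) * β ψ u * β ψ v
lemma3p4 ψ ψ-cdIndex u v = begin
    βP ψ (u · v)
  ≡⟨ βP-coeffOfPoly ψ N (u · v) (·-degree u v) ⟩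
    coeffOfPoly (u · v) (abCoeff (ψ N))
  ≡⟨ coeffOfPoly-· u v (ψ N) ⟩
    coeffOf⊗ (cdWord u) (cdWord v) (abCoeff (ψ N))
  ≡⟨ IsLinear.≗-cong (coeffOf⊗-isLinear (cdWord u) (cdWord v)) (abCoeff-cdIndex N (ψ N) (ψ-cdIndex N)) ⟩
    coeffOf⊗ (cdWord u) (cdWord v) (ΨB N)
  ≡⟨ coeffOf⊗-ΨB (cdWord u) (cdWord v) (degree-cdWord u) (degree-cdWord v) ⟩
    + binomial * coeffOf (cdWord u) (ΨB (deg u)) * coeffOf (cdWord v) (ΨB (deg v))
  ≡⟨ cong₂ (λ x y → + binomial * x * y) (β-coeffOf ψ ψ-cdIndex u) (β-coeffOf ψ ψ-cdIndex v) ⟨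
    + binomial * β ψ u * β ψ v
  ∎
  where
    N binomial : ℕ
    N = deg u + deg v + 1
    binomial = (deg u + deg v + 2) C (deg u + 1)
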